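{- Let $\underline{\alpha},\underline{\alpha}_1,\underline{\alpha}_2,\underline{\beta},\underline{\beta}_1,\underline{\beta}_2\in\mathbb{Z}^+_m$ with $\underline{\alpha}_1\underline{\alpha}_2=\underline{\beta}_1\underline{\beta}_2$, and let $A,B\in\mathbb{N}_m$ with $|A|,|B|\ge2$. If $(\underline{\alpha}\,\underline{\alpha}_2)(\underline{\alpha}_1A)=(\underline{\beta}\,\underline{\beta}_2)(\underline{\beta}_1B)$, then $\underline{\alpha}A=\underline{\beta}B$.
   Context: A multiset $M$ of nonnegative integers is described by its multiplicity function $\chi_M$; $|M|=\sum_n\chi_M(n)$. $\mathbb{N}_m$ is the family of multisets $M$ of nonnegative integers with $\chi_M(0)=1$ and $\chi_M(n)<\infty$ for $n\ge1$. $\mathbb{Z}^+_m$ is the set of finite vectors $(\alpha_1,\dots,\alpha_s)$ ($s\ge1$ arbitrary) of positive integers with $\alpha_1\le\cdots\le\alpha_s$. For a multiset $A$ and positive integer $k$, $kA=\{ka\}$ with multiplicities; sums of multisets count all pairs with multiplicity; $\underline{\alpha}A=\alpha_1A+\cdots+\alpha_sA$. For $\underline{\alpha}=(\alpha_1,\dots,\alpha_s)$, $\underline{\beta}=(\beta_1,\dots,\beta_t)$, the product $\underline{\alpha}\,\underline{\beta}\in\mathbb{Z}^+_m$ is the vector of all $st$ products $\alpha_i\beta_j$ arranged in nondecreasing order. -}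

module Defs where

open import Data.Nat using (ℕ; zero; suc; _+_; _*_; _∸_; _≤_; _<_; _≥_)
open import Data.Nat.Properties using (≤-decTotalOrder; ≤-totalOrder)
open import Data.Nat.DivMod using (_/_; _%_)
open import Data.List using (List; []; _∷_; map; concatMap; upTo)
open import Data.Nat.ListAction using (sum)
open import Data.List.Relation.Unary.All using (All)
open import Data.List.Relation.Unary.Sorted.TotalOrder using (Sorted)
open import Data.List.Sort.MergeSort ≤-decTotalOrder using (mergeSort)
open import Data.List.Sort.Base using (SortingAlgorithm)
open import Data.Product using (∃; _×_)
open import Relation.Binary.PropositionalEquality using (_≡_)
open import Relation.Nullary using (yes; no)
open import Data.Nat using (_≟_)

-- Vectors in ℤ⁺ₘ : finite nonempty nondecreasing lists of positive integers

data NonEmpty {A : Set} : List A → Set where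
  nonEmpty : ∀ x xs → NonEmpty (x ∷ xs)

IsZm : List ℕ → Set
IsZm v = NonEmpty v × All (λ a → 1 ≤ a) v × Sorted ≤-totalOrder v

sortℕ : List ℕ → List ℕ
sortℕ = SortingAlgorithm.sort mergeSort

_⊗_ : List ℕ → List ℕ → List ℕ
α ⊗ β = sortℕ (concatMap (λ a → map (a *_) β) α)

-- Multisets of nonnegative integers, given by multiplicity functions χ_M

Multiset : Set
Multiset = ℕ → ℕ

-- membership in ℕₘ : χ_M(0) = 1 (finiteness of χ_M(n) is automatic)
IsNm : Multiset → Set
IsNm M = M 0 ≡ 1

-- |M| ≥ k  (|M| = Σ_n χ_M(n), possibly infinite): some partial sum reaches k
CardAtLeast : ℕ → Multiset → Set
CardAtLeast k M = ∃ λ N → k ≤ sum (map M (upTo (suc N)))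

δ₀ : Multiset
δ₀ zero = 1
δ₀ (suc _) = 0

-- k A = { k a : a ∈ A } with multiplicities (only used for k ≥ 1)
scale : ℕ → Multiset → Multiset
scale zero A n = 0
scale (suc k) A n with n % suc k ≟ 0
... | yes _ = A (n / suc k)
... | no _ = 0

_⊕_ : Multiset → Multiset → Multiset
(A ⊕ B) n = sum (map (λ i → A i * B (n ∸ i)) (upTo (suc n)))

act : List ℕ → Multiset → Multiset
act [] A = δ₀
act (a ∷ []) A = scale a A
act (a ∷ as@(_ ∷ _)) A = scale a A ⊕ act as A

_≋_ : Multiset → Multiset → Set
A ≋ B = ∀ n → A n ≡ B n

-- Dilation and the sum of multisets make ℕₘ into a commutative monoid on which a
-- vector γ of positive integers acts by monoid endomorphisms A ↦ γA, with
-- (αβ)A = α(βA) and α(βA) = β(αA).  Both sides of the hypothesis are therefore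
-- γ(αA) and γ(βB) for γ = α₁α₂ = β₁β₂, and it remains to cancel γ.  With g the
-- least entry of γ, the value of γX at g·n depends only on X restricted to
-- [0, n] and is strictly monotone in X(n) because X(0) ≥ 1; applied at the first
-- n where αA and βB differ, this gives a contradiction.

module Submission where

open import Algebra.Bundles using (CommutativeMonoid; CommutativeSemigroup)
import Algebra.Properties.CommutativeSemigroup as CommutativeSemigroupProperties
open import Algebra.Structures using (IsCommutativeMonoid)
open import Data.Empty using (⊥-elim)
open import Data.List using (List; []; _∷_; _++_; map; concatMap; foldr; applyUpTo)
open import Data.List.Relation.Binary.Permutation.Propositional using (_↭_; ↭-sym; ↭⇒↭ₛ′)
open import Data.List.Relation.Binary.Permutation.Propositional.Properties using (map⁺; All-resp-↭; ↭-length)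
open import Data.List.Relation.Unary.All as All using (All; []; _∷_)
import Data.List.Relation.Unary.All.Properties as Allₚ
open import Data.List.Relation.Unary.AllPairs using (_∷_)
open import Data.List.Relation.Unary.Sorted.TotalOrder.Properties using (Sorted⇒AllPairs)
open import Data.List.Sort.Base using (SortingAlgorithm)
open import Data.Nat
open import Data.Nat.Divisibility using (_∣_; _∣?_; divides; divides-refl; _∣0; ∣⇒≤; ∣m+n∣m⇒∣n; ∣m∸n∣n⇒∣m; m%n≡0⇒n∣m)
open import Data.Nat.DivMod using (m*n/n≡m; m*n%n≡0)
open import Data.Nat.Induction using (<-rec)
open import Data.Nat.ListAction using (sum)
open import Data.Nat.Properties
open import Data.Product using (_,_)
open import Data.Sum using (inj₁; inj₂)
open import Function using (_∘_; id)
open import Level using (0ℓ)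
open import Relation.Binary.Bundles using (Setoid)
open import Relation.Binary.Definitions using (tri<; tri≈; tri>)
import Relation.Binary.Reasoning.Setoid as SetoidReasoning
open import Relation.Binary.Structures using (IsEquivalence)
open import Relation.Binary.PropositionalEquality
open import Relation.Nullary using (¬_; yes; no)

open import Defs
open import Data.List.Sort.MergeSort ≤-decTotalOrder using (mergeSort)

open CommutativeSemigroupProperties +-commutativeSemigroup using () renaming (interchange to +-interchange)

sum≤ : ℕ → (ℕ → ℕ) → ℕ
sum≤ zero    f = f 0
sum≤ (suc n) f = f 0 + sum≤ n (f ∘ suc)

infix 5 sum≤
syntax sum≤ n (λ i → e) = ∑[ i ≤ n ] e

sum-map-applyUpTo : ∀ (f h : ℕ → ℕ) n → sum (map f (applyUpTo h (suc n))) ≡ sum≤ n (f ∘ h)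
sum-map-applyUpTo f h zero    = +-identityʳ _
sum-map-applyUpTo f h (suc n) = cong (f (h 0) +_) (sum-map-applyUpTo f (h ∘ suc) n)

sum≤-suc : ∀ f n → sum≤ (suc n) f ≡ sum≤ n f + f (suc n)
sum≤-suc f zero    = refl
sum≤-suc f (suc n) = trans (cong (f 0 +_) (sum≤-suc (f ∘ suc) n)) (sym (+-assoc (f 0) _ _))

sum≤-cong : ∀ {f g} n → (∀ i → i ≤ n → f i ≡ g i) → sum≤ n f ≡ sum≤ n g
sum≤-cong zero    f≡g = f≡g 0 z≤n
sum≤-cong (suc n) f≡g = cong₂ _+_ (f≡g 0 z≤n) (sum≤-cong n (λ i i≤n → f≡g (suc i) (s≤s i≤n)))

sum≤-mono-≤ : ∀ {f g} n → (∀ i → i ≤ n → f i ≤ g i) → sum≤ n f ≤ sum≤ n g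
sum≤-mono-≤ zero    f≤g = f≤g 0 z≤n
sum≤-mono-≤ (suc n) f≤g = +-mono-≤ (f≤g 0 z≤n) (sum≤-mono-≤ n (λ i i≤n → f≤g (suc i) (s≤s i≤n)))

sum≤-mono-< : ∀ {f g} n → (∀ i → i ≤ n → f i ≤ g i) → f n < g n → sum≤ n f < sum≤ n g
sum≤-mono-< zero    f≤g fn<gn = fn<gn
sum≤-mono-< {f} {g} (suc n) f≤g fn<gn rewrite sum≤-suc f n | sum≤-suc g n =
  +-mono-≤-< (sum≤-mono-≤ n (λ i i≤n → f≤g i (m≤n⇒m≤1+n i≤n))) fn<gn

sum≤-zeros : ∀ {f} n → (∀ i → i ≤ n → f i ≡ 0) → sum≤ n f ≡ 0
sum≤-zeros zero    f≡0 = f≡0 0 z≤n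
sum≤-zeros (suc n) f≡0 = cong₂ _+_ (f≡0 0 z≤n) (sum≤-zeros n (λ i i≤n → f≡0 (suc i) (s≤s i≤n)))

sum≤-last : ∀ {f} n → (∀ i → i < n → f i ≡ 0) → sum≤ n f ≡ f n
sum≤-last zero        _   = refl
sum≤-last {f} (suc n) f≡0 =
  trans (sum≤-suc f n) (cong (_+ f (suc n)) (sum≤-zeros n (λ i i≤n → f≡0 i (s≤s i≤n))))

sum≤-distrib-+ : ∀ f g n → sum≤ n (λ i → f i + g i) ≡ sum≤ n f + sum≤ n g
sum≤-distrib-+ f g zero    = refl
sum≤-distrib-+ f g (suc n) =
  trans (cong (f 0 + g 0 +_) (sum≤-distrib-+ (f ∘ suc) (g ∘ suc) n)) (+-interchange (f 0) (g 0) _ _)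

*-distribˡ-sum≤ : ∀ c f n → c * sum≤ n f ≡ sum≤ n (λ i → c * f i)
*-distribˡ-sum≤ c f zero    = refl
*-distribˡ-sum≤ c f (suc n) = trans (*-distribˡ-+ c (f 0) _) (cong (c * f 0 +_) (*-distribˡ-sum≤ c (f ∘ suc) n))

sum≤-split : ∀ f m n → sum≤ (m + suc n) f ≡ sum≤ m f + sum≤ n (λ i → f (m + suc i))
sum≤-split f m zero    = begin
  sum≤ (m + 1) f           ≡⟨ cong (λ k → sum≤ k f) (+-comm m 1) ⟩
  sum≤ (suc m) f           ≡⟨ sum≤-suc f m ⟩
  sum≤ m f + f (suc m)     ≡⟨ cong (λ k → sum≤ m f + f k) (+-comm 1 m) ⟩
  sum≤ m f + f (m + 1)     ∎
  where open ≡-Reasoning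
sum≤-split f m (suc n) = begin
  sum≤ (m + suc (suc n)) f                  ≡⟨ cong (λ k → sum≤ k f) (+-suc m (suc n)) ⟩
  sum≤ (suc (m + suc n)) f                  ≡⟨ sum≤-suc f (m + suc n) ⟩
  sum≤ (m + suc n) f + f (suc (m + suc n))  ≡⟨ cong₂ _+_ (sum≤-split f m n) (cong f (sym (+-suc m (suc n)))) ⟩
  sum≤ m f + sum≤ n g + g (suc n)           ≡⟨ +-assoc (sum≤ m f) _ _ ⟩
  sum≤ m f + (sum≤ n g + g (suc n))         ≡⟨ cong (sum≤ m f +_) (sym (sum≤-suc g n)) ⟩
  sum≤ m f + sum≤ (suc n) g                 ∎
  where
  open ≡-Reasoning
  g : ℕ → ℕ
  g i = f (m + suc i)

sum≤-reverse : ∀ f n → sum≤ n f ≡ ∑[ i ≤ n ] f (n ∸ i)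
sum≤-reverse f zero    = refl
sum≤-reverse f (suc n) = begin
  f 0 + sum≤ n (f ∘ suc)                              ≡⟨ cong (f 0 +_) (sum≤-reverse (f ∘ suc) n) ⟩
  f 0 + (∑[ i ≤ n ] f (suc (n ∸ i)))                  ≡⟨ +-comm (f 0) _ ⟩
  (∑[ i ≤ n ] f (suc (n ∸ i))) + f 0                  ≡⟨ cong₂ _+_ (sum≤-cong n (λ i i≤n → cong f (sym (+-∸-assoc 1 i≤n))))
                                                                    (cong f (sym (n∸n≡0 n))) ⟩
  (∑[ i ≤ n ] f (suc n ∸ i)) + f (suc n ∸ suc n)      ≡⟨ sym (sum≤-suc (λ i → f (suc n ∸ i)) n) ⟩
  ∑[ i ≤ suc n ] f (suc n ∸ i)                        ∎
  where open ≡-Reasoning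

sum≤-triangle : ∀ (F : ℕ → ℕ → ℕ) n →
  (∑[ i ≤ n ] ∑[ j ≤ i ] F i j) ≡ (∑[ j ≤ n ] ∑[ k ≤ n ∸ j ] F (j + k) j)
sum≤-triangle F zero    = refl
sum≤-triangle F (suc n) = begin
  ∑[ i ≤ suc n ] ∑[ j ≤ i ] F i j                               ≡⟨ sum≤-suc _ n ⟩
  (∑[ i ≤ n ] ∑[ j ≤ i ] F i j) + sum≤ (suc n) (F (suc n))       ≡⟨ cong₂ _+_ (sum≤-triangle F n) (sum≤-suc _ n) ⟩
  sum≤ n column + (sum≤ n (F (suc n)) + F (suc n) (suc n))      ≡⟨ sym (+-assoc (sum≤ n column) _ _) ⟩
  sum≤ n column + sum≤ n (F (suc n)) + F (suc n) (suc n)        ≡⟨ cong₂ _+_ (sym (sum≤-distrib-+ column (F (suc n)) n))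
                                                                            (cong (λ i → F i (suc n)) (sym (+-identityʳ (suc n)))) ⟩
  (∑[ j ≤ n ] column j + F (suc n) j) + F (suc n + 0) (suc n)   ≡⟨ cong₂ _+_ (sum≤-cong n extend-column)
                                                                            (cong (λ m → sum≤ m (λ k → F (suc n + k) (suc n))) (sym (n∸n≡0 n))) ⟩
  sum≤ n column′ + column′ (suc n)                              ≡⟨ sym (sum≤-suc column′ n) ⟩
  sum≤ (suc n) column′                                          ∎
  where
  open ≡-Reasoning
  column column′ : ℕ → ℕ
  column  j = ∑[ k ≤ n ∸ j ] F (j + k) j
  column′ j = ∑[ k ≤ suc n ∸ j ] F (j + k) j
  extend-column : ∀ j → j ≤ n → column j + F (suc n) j ≡ column′ j
  extend-column j j≤n = begin
    column j + F (suc n) j                 ≡⟨ cong (λ i → column j + F i j) (sym (trans (+-suc j (n ∸ j)) (cong suc (m+[n∸m]≡n j≤n)))) ⟩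
    column j + F (j + suc (n ∸ j)) j       ≡⟨ sym (sum≤-suc (λ k → F (j + k) j) (n ∸ j)) ⟩
    sum≤ (suc (n ∸ j)) (λ k → F (j + k) j) ≡⟨ cong (λ m → sum≤ m (λ k → F (j + k) j)) (sym (+-∸-assoc 1 j≤n)) ⟩
    column′ j                              ∎

sum≤-dilate : ∀ k f q → (∀ i → ¬ (suc k ∣ i) → f i ≡ 0) → sum≤ (suc k * q) f ≡ ∑[ j ≤ q ] f (suc k * j)
sum≤-dilate k f zero    f≡0 = trans (cong (λ m → sum≤ m f) (*-zeroʳ (suc k))) (cong f (sym (*-zeroʳ (suc k))))
sum≤-dilate k f (suc q) f≡0 = begin
  sum≤ (K * suc q) f                              ≡⟨ cong (λ m → sum≤ m f) K[1+q]≡Kq+K ⟩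
  sum≤ (K * q + suc k) f                          ≡⟨ sum≤-split f (K * q) k ⟩
  sum≤ (K * q) f + (∑[ i ≤ k ] f (K * q + suc i)) ≡⟨ cong₂ _+_ (sum≤-dilate k f q f≡0) (sum≤-last k strictly-between) ⟩
  sum≤ q g + f (K * q + suc k)                    ≡⟨ cong (λ m → sum≤ q g + f m) (sym K[1+q]≡Kq+K) ⟩
  sum≤ q g + g (suc q)                            ≡⟨ sym (sum≤-suc g q) ⟩
  sum≤ (suc q) g                                  ∎
  where
  open ≡-Reasoning
  K = suc k
  g : ℕ → ℕ
  g j = f (K * j)
  K[1+q]≡Kq+K : K * suc q ≡ K * q + suc k
  K[1+q]≡Kq+K = trans (*-suc K q) (+-comm K (K * q))
  strictly-between : ∀ i → i < k → f (K * q + suc i) ≡ 0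
  strictly-between i i<k = f≡0 _ (λ K∣ → <⇒≱ i<k (s≤s⁻¹ (∣⇒≤ (∣m+n∣m⇒∣n K∣ (divides q (*-comm K q))))))

≋-isEquivalence : IsEquivalence _≋_
≋-isEquivalence = record
  { refl  = λ _ → refl
  ; sym   = λ A≋B n → sym (A≋B n)
  ; trans = λ A≋B B≋C n → trans (A≋B n) (B≋C n)
  }

open IsEquivalence ≋-isEquivalence using () renaming (refl to ≋-refl; sym to ≋-sym; trans to ≋-trans)

multisetSetoid : Setoid 0ℓ 0ℓ
multisetSetoid = record { isEquivalence = ≋-isEquivalence }

open import Data.List.Relation.Binary.Permutation.Setoid.Properties multisetSetoid using (foldr-commMonoid)

⊕-sum≤ : ∀ A B n → (A ⊕ B) n ≡ ∑[ i ≤ n ] A i * B (n ∸ i)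
⊕-sum≤ A B n = sum-map-applyUpTo (λ i → A i * B (n ∸ i)) id n

⊕-cong : ∀ {A A′ B B′} → A ≋ A′ → B ≋ B′ → (A ⊕ B) ≋ (A′ ⊕ B′)
⊕-cong {A} {A′} {B} {B′} A≋A′ B≋B′ n = begin
  (A ⊕ B) n                          ≡⟨ ⊕-sum≤ A B n ⟩
  ∑[ i ≤ n ] A i * B (n ∸ i)         ≡⟨ sum≤-cong n (λ i _ → cong₂ _*_ (A≋A′ i) (B≋B′ (n ∸ i))) ⟩
  ∑[ i ≤ n ] A′ i * B′ (n ∸ i)       ≡⟨ sym (⊕-sum≤ A′ B′ n) ⟩
  (A′ ⊕ B′) n                        ∎
  where open ≡-Reasoning

⊕-comm : ∀ A B → (A ⊕ B) ≋ (B ⊕ A)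
⊕-comm A B n = begin
  (A ⊕ B) n                                 ≡⟨ ⊕-sum≤ A B n ⟩
  ∑[ i ≤ n ] A i * B (n ∸ i)                ≡⟨ sum≤-reverse _ n ⟩
  ∑[ i ≤ n ] A (n ∸ i) * B (n ∸ (n ∸ i))    ≡⟨ sum≤-cong n swap ⟩
  ∑[ i ≤ n ] B i * A (n ∸ i)                ≡⟨ sym (⊕-sum≤ B A n) ⟩
  (B ⊕ A) n                                 ∎
  where
  open ≡-Reasoning
  swap : ∀ i → i ≤ n → A (n ∸ i) * B (n ∸ (n ∸ i)) ≡ B i * A (n ∸ i)
  swap i i≤n = trans (*-comm (A (n ∸ i)) _) (cong (λ m → B m * A (n ∸ i)) (m∸[m∸n]≡n i≤n))

⊕-assoc : ∀ A B C → ((A ⊕ B) ⊕ C) ≋ (A ⊕ (B ⊕ C))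
⊕-assoc A B C n = begin
  ((A ⊕ B) ⊕ C) n                                 ≡⟨ ⊕-sum≤ (A ⊕ B) C n ⟩
  ∑[ i ≤ n ] (A ⊕ B) i * C (n ∸ i)                ≡⟨ sum≤-cong n (λ i _ → expand-left i) ⟩
  ∑[ i ≤ n ] ∑[ j ≤ i ] F i j                     ≡⟨ sum≤-triangle F n ⟩
  ∑[ j ≤ n ] ∑[ k ≤ n ∸ j ] F (j + k) j           ≡⟨ sum≤-cong n (λ j _ → collect-right j) ⟩
  ∑[ j ≤ n ] A j * (B ⊕ C) (n ∸ j)                ≡⟨ sym (⊕-sum≤ A (B ⊕ C) n) ⟩
  (A ⊕ (B ⊕ C)) n                                 ∎
  where
  open ≡-Reasoning
  F : ℕ → ℕ → ℕ
  F i j = C (n ∸ i) * (A j * B (i ∸ j))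
  expand-left : ∀ i → (A ⊕ B) i * C (n ∸ i) ≡ ∑[ j ≤ i ] F i j
  expand-left i = begin
    (A ⊕ B) i * C (n ∸ i)                         ≡⟨ *-comm _ (C (n ∸ i)) ⟩
    C (n ∸ i) * (A ⊕ B) i                         ≡⟨ cong (C (n ∸ i) *_) (⊕-sum≤ A B i) ⟩
    C (n ∸ i) * (∑[ j ≤ i ] A j * B (i ∸ j))      ≡⟨ *-distribˡ-sum≤ (C (n ∸ i)) _ i ⟩
    ∑[ j ≤ i ] F i j                              ∎
  F-reindex : ∀ j k → F (j + k) j ≡ A j * (B k * C (n ∸ j ∸ k))
  F-reindex j k rewrite m+n∸m≡n j k | ∸-+-assoc n j k =
    trans (*-comm (C (n ∸ (j + k))) _) (*-assoc (A j) (B k) _)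
  collect-right : ∀ j → (∑[ k ≤ n ∸ j ] F (j + k) j) ≡ A j * (B ⊕ C) (n ∸ j)
  collect-right j = begin
    ∑[ k ≤ n ∸ j ] F (j + k) j                    ≡⟨ sum≤-cong (n ∸ j) (λ k _ → F-reindex j k) ⟩
    ∑[ k ≤ n ∸ j ] A j * (B k * C (n ∸ j ∸ k))    ≡⟨ sym (*-distribˡ-sum≤ (A j) _ (n ∸ j)) ⟩
    A j * (∑[ k ≤ n ∸ j ] B k * C (n ∸ j ∸ k))    ≡⟨ cong (A j *_) (sym (⊕-sum≤ B C (n ∸ j))) ⟩
    A j * (B ⊕ C) (n ∸ j)                         ∎

⊕-identityˡ : ∀ A → (δ₀ ⊕ A) ≋ A
⊕-identityˡ A zero    = trans (⊕-sum≤ δ₀ A 0) (+-identityʳ _)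
⊕-identityˡ A (suc n) = begin
  (δ₀ ⊕ A) (suc n)                            ≡⟨ ⊕-sum≤ δ₀ A (suc n) ⟩
  A (suc n) + 0 + (∑[ i ≤ n ] 0 * A (n ∸ i))  ≡⟨ cong (A (suc n) + 0 +_) (sum≤-zeros n (λ _ _ → refl)) ⟩
  A (suc n) + 0 + 0                           ≡⟨ trans (+-identityʳ _) (+-identityʳ _) ⟩
  A (suc n)                                   ∎
  where open ≡-Reasoning

⊕-identityʳ : ∀ A → (A ⊕ δ₀) ≋ A
⊕-identityʳ A = ≋-trans (⊕-comm A δ₀) (⊕-identityˡ A)

⊕-isCommutativeMonoid : IsCommutativeMonoid _≋_ _⊕_ δ₀
⊕-isCommutativeMonoid = record
  { isMonoid = record
    { isSemigroup = record
      { isMagma = record { isEquivalence = ≋-isEquivalence ; ∙-cong = ⊕-cong }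
      ; assoc   = ⊕-assoc
      }
    ; identity = ⊕-identityˡ , ⊕-identityʳ
    }
  ; comm = ⊕-comm
  }

⊕-commutativeSemigroup : CommutativeSemigroup 0ℓ 0ℓ
⊕-commutativeSemigroup = CommutativeMonoid.commutativeSemigroup (record { isCommutativeMonoid = ⊕-isCommutativeMonoid })

open CommutativeSemigroupProperties ⊕-commutativeSemigroup using () renaming (interchange to ⊕-interchange)

data MultipleView (k : ℕ) : ℕ → Set where
  multiple    : ∀ q → MultipleView k (k * q)
  nonMultiple : ∀ {n} → ¬ (k ∣ n) → MultipleView k n

multipleView : ∀ k n → MultipleView k n
multipleView k n with k ∣? n
... | yes (divides-refl q) = subst (MultipleView k) (*-comm k q) (multiple q)
... | no k∤n              = nonMultiple k∤n

scale-multiple : ∀ k A q → scale (suc k) A (suc k * q) ≡ A q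
scale-multiple k A q with (suc k * q) % suc k ≟ 0
... | yes _   = cong A (trans (cong (_/ suc k) (*-comm (suc k) q)) (m*n/n≡m q (suc k)))
... | no ≢0   = ⊥-elim (≢0 (trans (cong (_% suc k) (*-comm (suc k) q)) (m*n%n≡0 q (suc k))))

scale-nonMultiple : ∀ k A {n} → ¬ (suc k ∣ n) → scale (suc k) A n ≡ 0
scale-nonMultiple k A {n} k∤n with n % suc k ≟ 0
... | yes ≡0 = ⊥-elim (k∤n (m%n≡0⇒n∣m n (suc k) ≡0))
... | no _   = refl

scale-zero : ∀ k A → scale (suc k) A 0 ≡ A 0
scale-zero k A = trans (cong (scale (suc k) A) (sym (*-zeroʳ (suc k)))) (scale-multiple k A 0)

scale-cong : ∀ k {A B} → A ≋ B → scale k A ≋ scale k B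
scale-cong zero    A≋B n = refl
scale-cong (suc k) A≋B n with n % suc k ≟ 0
... | yes _ = A≋B _
... | no _  = refl

scale-δ₀ : ∀ k → scale (suc k) δ₀ ≋ δ₀
scale-δ₀ k n with multipleView (suc k) n
... | multiple zero    = trans (scale-multiple k δ₀ 0) (cong δ₀ (sym (*-zeroʳ (suc k))))
... | multiple (suc q) = scale-multiple k δ₀ (suc q)
scale-δ₀ k zero    | nonMultiple k∤0 = ⊥-elim (k∤0 (suc k ∣0))
scale-δ₀ k (suc n) | nonMultiple k∤n = scale-nonMultiple k δ₀ k∤n

scale-∘ : ∀ a b X → scale (suc a) (scale (suc b) X) ≋ scale (suc a * suc b) X
scale-∘ a b X n with multipleView (suc a * suc b) n
... | multiple q = begin
  scale (suc a) (scale (suc b) X) (suc a * suc b * q)   ≡⟨ cong (scale (suc a) (scale (suc b) X)) (*-assoc (suc a) (suc b) q) ⟩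
  scale (suc a) (scale (suc b) X) (suc a * (suc b * q)) ≡⟨ scale-multiple a _ (suc b * q) ⟩
  scale (suc b) X (suc b * q)                           ≡⟨ scale-multiple b X q ⟩
  X q                                                   ≡⟨ sym (scale-multiple (b + a * suc b) X q) ⟩
  scale (suc a * suc b) X (suc a * suc b * q)           ∎
  where open ≡-Reasoning
... | nonMultiple ab∤n = trans vanishes (sym (scale-nonMultiple (b + a * suc b) X ab∤n))
  where
  vanishes : scale (suc a) (scale (suc b) X) n ≡ 0
  vanishes with multipleView (suc a) n
  ... | nonMultiple a∤n = scale-nonMultiple a _ a∤n
  ... | multiple r with multipleView (suc b) r
  ...   | nonMultiple b∤r = trans (scale-multiple a _ r) (scale-nonMultiple b X b∤r)
  ...   | multiple q      = ⊥-elim (ab∤n (divides q (trans (sym (*-assoc (suc a) (suc b) q)) (*-comm (suc a * suc b) q))))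

scale-distrib-⊕ : ∀ k A B → scale (suc k) (A ⊕ B) ≋ (scale (suc k) A ⊕ scale (suc k) B)
scale-distrib-⊕ k A B n with multipleView (suc k) n
... | multiple q = sym (begin
  (kA ⊕ kB) (K * q)                                 ≡⟨ ⊕-sum≤ kA kB (K * q) ⟩
  ∑[ i ≤ K * q ] kA i * kB (K * q ∸ i)              ≡⟨ sum≤-dilate k _ q (λ i k∤i → cong (_* kB (K * q ∸ i)) (scale-nonMultiple k A k∤i)) ⟩
  ∑[ j ≤ q ] kA (K * j) * kB (K * q ∸ K * j)        ≡⟨ sum≤-cong q (λ j _ → cong₂ _*_ (scale-multiple k A j) (at-multiple j)) ⟩
  ∑[ j ≤ q ] A j * B (q ∸ j)                        ≡⟨ sym (⊕-sum≤ A B q) ⟩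
  (A ⊕ B) q                                         ≡⟨ sym (scale-multiple k (A ⊕ B) q) ⟩
  scale K (A ⊕ B) (K * q)                           ∎)
  where
  open ≡-Reasoning
  K = suc k
  kA = scale K A
  kB = scale K B
  at-multiple : ∀ j → kB (K * q ∸ K * j) ≡ B (q ∸ j)
  at-multiple j = trans (cong kB (sym (*-distribˡ-∸ K q j))) (scale-multiple k B (q ∸ j))
... | nonMultiple k∤n =
  trans (scale-nonMultiple k (A ⊕ B) k∤n) (sym (trans (⊕-sum≤ kA kB n) (sum≤-zeros n term-vanishes)))
  where
  kA = scale (suc k) A
  kB = scale (suc k) B
  term-vanishes : ∀ i → i ≤ n → kA i * kB (n ∸ i) ≡ 0
  term-vanishes i i≤n with multipleView (suc k) i
  ... | nonMultiple k∤i = cong (_* kB (n ∸ i)) (scale-nonMultiple k A k∤i)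
  ... | multiple j      = trans (cong (kA (suc k * j) *_) (scale-nonMultiple k B k∤n∸i)) (*-zeroʳ (kA (suc k * j)))
    where
    k∤n∸i : ¬ (suc k ∣ n ∸ suc k * j)
    k∤n∸i k∣ = k∤n (∣m∸n∣n⇒∣m (suc k) i≤n k∣ (divides j (*-comm (suc k) j)))

Positive : List ℕ → Set
Positive = All (1 ≤_)

act′ : List ℕ → Multiset → Multiset
act′ γ A = foldr _⊕_ δ₀ (map (λ a → scale a A) γ)

act≋act′ : ∀ γ A → act γ A ≋ act′ γ A
act≋act′ []          A = ≋-refl
act≋act′ (a ∷ [])    A = ≋-sym (⊕-identityʳ (scale a A))
act≋act′ (a ∷ b ∷ γ) A = ⊕-cong (≋-refl {scale a A}) (act≋act′ (b ∷ γ) A)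

act′-cong : ∀ γ {A B} → A ≋ B → act′ γ A ≋ act′ γ B
act′-cong []      A≋B = ≋-refl
act′-cong (a ∷ γ) A≋B = ⊕-cong (scale-cong a A≋B) (act′-cong γ A≋B)

act′-resp-↭ : ∀ A {γ γ′} → γ ↭ γ′ → act′ γ A ≋ act′ γ′ A
act′-resp-↭ A γ↭γ′ = foldr-commMonoid ⊕-isCommutativeMonoid (↭⇒↭ₛ′ ≋-isEquivalence (map⁺ (λ a → scale a A) γ↭γ′))

act′-++ : ∀ γ γ′ A → act′ (γ ++ γ′) A ≋ (act′ γ A ⊕ act′ γ′ A)
act′-++ []      γ′ A = ≋-sym (⊕-identityˡ _)
act′-++ (a ∷ γ) γ′ A = ≋-trans (⊕-cong (≋-refl {scale a A}) (act′-++ γ γ′ A)) (≋-sym (⊕-assoc (scale a A) _ _))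

act′-δ₀ : ∀ {γ} → Positive γ → act′ γ δ₀ ≋ δ₀
act′-δ₀ []                        = ≋-refl
act′-δ₀ {suc a ∷ γ} (s≤s z≤n ∷ p) = ≋-trans (⊕-cong (scale-δ₀ a) (act′-δ₀ p)) (⊕-identityˡ δ₀)

act′-distrib-⊕ : ∀ {γ} → Positive γ → ∀ A B → act′ γ (A ⊕ B) ≋ (act′ γ A ⊕ act′ γ B)
act′-distrib-⊕ []                        A B = ≋-sym (⊕-identityˡ δ₀)
act′-distrib-⊕ {suc a ∷ γ} (s≤s z≤n ∷ p) A B =
  ≋-trans (⊕-cong (scale-distrib-⊕ a A B) (act′-distrib-⊕ p A B))
          (⊕-interchange (scale (suc a) A) (scale (suc a) B) (act′ γ A) (act′ γ B))

act′-map-* : ∀ a {β} → Positive β → ∀ A → act′ (map (suc a *_) β) A ≋ scale (suc a) (act′ β A)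
act′-map-* a []                        A = ≋-sym (scale-δ₀ a)
act′-map-* a {suc b ∷ β} (s≤s z≤n ∷ p) A =
  ≋-trans (⊕-cong (≋-sym (scale-∘ a b A)) (act′-map-* a p A)) (≋-sym (scale-distrib-⊕ a (scale (suc b) A) (act′ β A)))

act′-concatMap : ∀ {α β} → Positive α → Positive β → ∀ A →
  act′ (concatMap (λ a → map (a *_) β) α) A ≋ act′ α (act′ β A)
act′-concatMap []                            pβ A = ≋-refl
act′-concatMap {suc a ∷ α} {β} (s≤s z≤n ∷ pα) pβ A =
  ≋-trans (act′-++ (map (suc a *_) β) (concatMap (λ a → map (a *_) β) α) A)
          (⊕-cong (act′-map-* a pβ A) (act′-concatMap pα pβ A))

act′-⊗ : ∀ {α β} → Positive α → Positive β → ∀ A → act′ (α ⊗ β) A ≋ act′ α (act′ β A)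
act′-⊗ {α} {β} pα pβ A =
  ≋-trans (act′-resp-↭ A (SortingAlgorithm.sort-↭ mergeSort (concatMap (λ a → map (a *_) β) α))) (act′-concatMap pα pβ A)

scale-act′-comm : ∀ a {β} → Positive β → ∀ A → scale (suc a) (act′ β A) ≋ act′ β (scale (suc a) A)
scale-act′-comm a []                        A = scale-δ₀ a
scale-act′-comm a {suc b ∷ β} (s≤s z≤n ∷ p) A =
  ≋-trans (scale-distrib-⊕ a (scale (suc b) A) (act′ β A)) (⊕-cong ab≋ba (scale-act′-comm a p A))
  where
  ab≋ba : scale (suc a) (scale (suc b) A) ≋ scale (suc b) (scale (suc a) A)
  ab≋ba n = begin
    scale (suc a) (scale (suc b) A) n  ≡⟨ scale-∘ a b A n ⟩
    scale (suc a * suc b) A n          ≡⟨ cong (λ k → scale k A n) (*-comm (suc a) (suc b)) ⟩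
    scale (suc b * suc a) A n          ≡⟨ sym (scale-∘ b a A n) ⟩
    scale (suc b) (scale (suc a) A) n  ∎
    where open ≡-Reasoning

act′-comm : ∀ {α β} → Positive α → Positive β → ∀ A → act′ α (act′ β A) ≋ act′ β (act′ α A)
act′-comm []                            pβ A = ≋-sym (act′-δ₀ pβ)
act′-comm {suc a ∷ α} {β} (s≤s z≤n ∷ pα) pβ A =
  ≋-trans (⊕-cong (scale-act′-comm a pβ A) (act′-comm pα pβ A)) (≋-sym (act′-distrib-⊕ pβ (scale (suc a) A) (act′ α A)))

_≤ₘ_ : Multiset → Multiset → Set
A ≤ₘ B = ∀ n → A n ≤ B n

⊕-mono-≤ : ∀ {A A′ B B′} → A ≤ₘ A′ → B ≤ₘ B′ → (A ⊕ B) ≤ₘ (A′ ⊕ B′)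
⊕-mono-≤ {A} {A′} {B} {B′} A≤A′ B≤B′ n rewrite ⊕-sum≤ A B n | ⊕-sum≤ A′ B′ n =
  sum≤-mono-≤ n (λ i _ → *-mono-≤ (A≤A′ i) (B≤B′ (n ∸ i)))

scale-mono-≤ : ∀ k {A B} → A ≤ₘ B → scale k A ≤ₘ scale k B
scale-mono-≤ zero    A≤B n = z≤n
scale-mono-≤ (suc k) A≤B n with n % suc k ≟ 0
... | yes _ = A≤B _
... | no _  = z≤n

act′-mono-≤ : ∀ γ {A B} → A ≤ₘ B → act′ γ A ≤ₘ act′ γ B
act′-mono-≤ []      A≤B n = ≤-refl
act′-mono-≤ (a ∷ γ) A≤B   = ⊕-mono-≤ (scale-mono-≤ a A≤B) (act′-mono-≤ γ A≤B)

act′-zero-positive : ∀ {γ} → Positive γ → ∀ A → 1 ≤ A 0 → 1 ≤ act′ γ A 0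
act′-zero-positive []                        A A₀≥1 = ≤-refl
act′-zero-positive {suc a ∷ γ} (s≤s z≤n ∷ p) A A₀≥1
  rewrite ⊕-sum≤ (scale (suc a) A) (act′ γ A) 0 | scale-zero a A = *-mono-≤ A₀≥1 (act′-zero-positive p A A₀≥1)

scale-local : ∀ g b {A B n} → suc g ≤ suc b → (∀ m → m ≤ n → A m ≡ B m) →
  ∀ i → i ≤ suc g * n → scale (suc b) A i ≡ scale (suc b) B i
scale-local g b {A} {B} {n} g≤b A≡B i i≤gn with multipleView (suc b) i
... | nonMultiple b∤i = trans (scale-nonMultiple b A b∤i) (sym (scale-nonMultiple b B b∤i))
... | multiple q      = trans (scale-multiple b A q) (trans (A≡B q q≤n) (sym (scale-multiple b B q)))
  where
  q≤n : q ≤ n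
  q≤n = *-cancelˡ-≤ (suc b) (≤-trans i≤gn (*-monoˡ-≤ n g≤b))

act′-local : ∀ g {γ} → All (suc g ≤_) γ → ∀ {A B n} → (∀ m → m ≤ n → A m ≡ B m) →
  ∀ m → m ≤ suc g * n → act′ γ A m ≡ act′ γ B m
act′-local g []                         A≡B m m≤gn = refl
act′-local g {suc b ∷ γ} (g≤b ∷ g≤γ) {A} {B} A≡B m m≤gn = begin
  act′ (suc b ∷ γ) A m                                     ≡⟨ ⊕-sum≤ (scale (suc b) A) (act′ γ A) m ⟩
  ∑[ i ≤ m ] scale (suc b) A i * act′ γ A (m ∸ i)          ≡⟨ sum≤-cong m (λ i i≤m → cong₂ _*_
                                                                 (scale-local g b g≤b A≡B i (≤-trans i≤m m≤gn))
                                                                 (act′-local g g≤γ A≡B (m ∸ i) (≤-trans (m∸n≤m m i) m≤gn))) ⟩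
  ∑[ i ≤ m ] scale (suc b) B i * act′ γ B (m ∸ i)          ≡⟨ sym (⊕-sum≤ (scale (suc b) B) (act′ γ B) m) ⟩
  act′ (suc b ∷ γ) B m                                     ∎
  where open ≡-Reasoning

act′-mono-< : ∀ g {γ} → Positive γ → ∀ {A B} → A ≤ₘ B → 1 ≤ A 0 → ∀ n → A n < B n →
  act′ (suc g ∷ γ) A (suc g * n) < act′ (suc g ∷ γ) B (suc g * n)
act′-mono-< g {γ} p {A} {B} A≤B A₀≥1 n Aₙ<Bₙ
  rewrite ⊕-sum≤ (scale (suc g) A) (act′ γ A) (suc g * n) | ⊕-sum≤ (scale (suc g) B) (act′ γ B) (suc g * n) =
  sum≤-mono-< (suc g * n) (λ i _ → *-mono-≤ (scale-mono-≤ (suc g) A≤B i) (act′-mono-≤ γ A≤B _)) last-term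
  where
  last-term : scale (suc g) A (suc g * n) * act′ γ A (suc g * n ∸ suc g * n)
            < scale (suc g) B (suc g * n) * act′ γ B (suc g * n ∸ suc g * n)
  last-term rewrite n∸n≡0 (suc g * n) | scale-multiple g A n | scale-multiple g B n =
    <-≤-trans (*-monoˡ-< _ {{>-nonZero (act′-zero-positive p A A₀≥1)}} Aₙ<Bₙ) (*-monoʳ-≤ (B n) (act′-mono-≤ γ A≤B 0))

truncate : ℕ → Multiset → Multiset
truncate n A m with m ≤? n
... | yes _ = A m
... | no _  = 0

truncate-agrees : ∀ n A m → m ≤ n → A m ≡ truncate n A m
truncate-agrees n A m m≤n with m ≤? n
... | yes _   = refl
... | no m≰n  = ⊥-elim (m≰n m≤n)

truncate-mono-≤ : ∀ n {A B} → (∀ {m} → m < n → A m ≡ B m) → A n ≤ B n → truncate n A ≤ₘ truncate n B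
truncate-mono-≤ n A≡B Aₙ≤Bₙ m with m ≤? n
... | no _    = z≤n
... | yes m≤n with m≤n⇒m<n∨m≡n m≤n
...   | inj₁ m<n  = ≤-reflexive (A≡B m<n)
...   | inj₂ refl = Aₙ≤Bₙ

-- Truncation above n makes A and B pointwise comparable without changing the
-- value at g·n.
act′-separates : ∀ g {γ} → All (suc g ≤_) γ → ∀ {A B} → 1 ≤ A 0 → ∀ n →
  (∀ {m} → m < n → A m ≡ B m) → A n < B n →
  act′ (suc g ∷ γ) A (suc g * n) < act′ (suc g ∷ γ) B (suc g * n)
act′-separates g {γ} g≤γ {A} {B} A₀≥1 n A≡B Aₙ<Bₙ = begin-strict
  act′ γ′ A (suc g * n)              ≡⟨ act′-local g g≤γ′ (truncate-agrees n A) _ ≤-refl ⟩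
  act′ γ′ (truncate n A) (suc g * n) <⟨ act′-mono-< g positive (truncate-mono-≤ n A≡B (<⇒≤ Aₙ<Bₙ)) A′₀≥1 n A′ₙ<B′ₙ ⟩
  act′ γ′ (truncate n B) (suc g * n) ≡⟨ act′-local g g≤γ′ (truncate-agrees n B) _ ≤-refl ⟨
  act′ γ′ B (suc g * n)              ∎
  where
  open ≤-Reasoning
  γ′ = suc g ∷ γ
  g≤γ′ : All (suc g ≤_) γ′
  g≤γ′ = ≤-refl ∷ g≤γ
  positive : Positive γ
  positive = All.map (≤-trans (s≤s z≤n)) g≤γ
  A′₀≥1 : 1 ≤ truncate n A 0
  A′₀≥1 = ≤-trans A₀≥1 (≤-reflexive (truncate-agrees n A 0 z≤n))
  A′ₙ<B′ₙ : truncate n A n < truncate n B n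
  A′ₙ<B′ₙ = subst₂ _<_ (truncate-agrees n A n ≤-refl) (truncate-agrees n B n ≤-refl) Aₙ<Bₙ

act′-cancel : ∀ g {γ} → All (suc g ≤_) γ → ∀ {A B} → 1 ≤ A 0 → 1 ≤ B 0 →
  act′ (suc g ∷ γ) A ≋ act′ (suc g ∷ γ) B → A ≋ B
act′-cancel g g≤γ {A} {B} A₀≥1 B₀≥1 gA≋gB = <-rec (λ n → A n ≡ B n) agree-at
  where
  agree-at : ∀ n → (∀ {m} → m < n → A m ≡ B m) → A n ≡ B n
  agree-at n A≡B with <-cmp (A n) (B n)
  ... | tri≈ _ Aₙ≡Bₙ _ = Aₙ≡Bₙ
  ... | tri< Aₙ<Bₙ _ _ = ⊥-elim (<-irrefl (gA≋gB _) (act′-separates g g≤γ A₀≥1 n A≡B Aₙ<Bₙ))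
  ... | tri> _ _ Bₙ<Aₙ = ⊥-elim (<-irrefl (sym (gA≋gB _)) (act′-separates g g≤γ B₀≥1 n (sym ∘ A≡B) Bₙ<Aₙ))

act′-injective : ∀ {γ} → IsZm γ → ∀ {A B} → 1 ≤ A 0 → 1 ≤ B 0 → act′ γ A ≋ act′ γ B → A ≋ B
act′-injective (nonEmpty (suc g) γ , s≤s z≤n ∷ _ , sorted) with Sorted⇒AllPairs ≤-totalOrder sorted
... | g≤γ ∷ _ = act′-cancel g g≤γ

nonEmpty-resp-↭ : ∀ {A : Set} {xs ys : List A} → xs ↭ ys → NonEmpty ys → NonEmpty xs
nonEmpty-resp-↭ {xs = []}     xs↭ys (nonEmpty _ _) = ⊥-elim (0≢1+n (↭-length xs↭ys))
nonEmpty-resp-↭ {xs = x ∷ xs} _     _              = nonEmpty x xs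

sort↭products : ∀ α β → α ⊗ β ↭ concatMap (λ a → map (a *_) β) α
sort↭products α β = SortingAlgorithm.sort-↭ mergeSort (concatMap (λ a → map (a *_) β) α)

⊗-positive : ∀ {α β} → Positive α → Positive β → Positive (α ⊗ β)
⊗-positive {α} {β} pα pβ = All-resp-↭ (↭-sym (sort↭products α β))
  (Allₚ.concat⁺ (Allₚ.map⁺ (All.map (λ 1≤a → Allₚ.map⁺ (All.map (*-mono-≤ 1≤a) pβ)) pα)))

⊗-isZm : ∀ {α β} → IsZm α → IsZm β → IsZm (α ⊗ β)
⊗-isZm {α} {β} (nonEmpty a _ , pα , _) (nonEmpty b _ , pβ , _) =
  nonEmpty-resp-↭ (sort↭products α β) (nonEmpty (a * b) _) ,
  ⊗-positive pα pβ ,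
  SortingAlgorithm.sort-↗ mergeSort (concatMap (λ a → map (a *_) β) α)

act-⊗-act : ∀ {α α₁ α₂} → Positive α → Positive α₁ → Positive α₂ → ∀ A →
  act (α ⊗ α₂) (act α₁ A) ≋ act′ (α₁ ⊗ α₂) (act′ α A)
act-⊗-act {α} {α₁} {α₂} pα pα₁ pα₂ A = begin
  act (α ⊗ α₂) (act α₁ A)        ≈⟨ act≋act′ (α ⊗ α₂) (act α₁ A) ⟩
  act′ (α ⊗ α₂) (act α₁ A)       ≈⟨ act′-cong (α ⊗ α₂) (act≋act′ α₁ A) ⟩
  act′ (α ⊗ α₂) (act′ α₁ A)      ≈⟨ act′-⊗ pα pα₂ (act′ α₁ A) ⟩
  act′ α (act′ α₂ (act′ α₁ A))   ≈⟨ act′-cong α (act′-comm pα₂ pα₁ A) ⟩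
  act′ α (act′ α₁ (act′ α₂ A))   ≈⟨ act′-cong α (act′-⊗ pα₁ pα₂ A) ⟨
  act′ α (act′ (α₁ ⊗ α₂) A)      ≈⟨ act′-comm pα (⊗-positive pα₁ pα₂) A ⟩
  act′ (α₁ ⊗ α₂) (act′ α A)      ∎
  where open SetoidReasoning multisetSetoid

proposition1p10 : (α α₁ α₂ β β₁ β₂ : List ℕ) →
    IsZm α → IsZm α₁ → IsZm α₂ → IsZm β → IsZm β₁ → IsZm β₂ →
    α₁ ⊗ α₂ ≡ β₁ ⊗ β₂ →
    (A B : Multiset) → IsNm A → IsNm B → CardAtLeast 2 A → CardAtLeast 2 B →
    act (α ⊗ α₂) (act α₁ A) ≋ act (β ⊗ β₂) (act β₁ B) →
    act α A ≋ act β B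
proposition1p10 α α₁ α₂ β β₁ β₂ (_ , pα , _) zα₁@(_ , pα₁ , _) zα₂@(_ , pα₂ , _) (_ , pβ , _) (_ , pβ₁ , _) (_ , pβ₂ , _)
  α₁α₂≡β₁β₂ A B A₀≡1 B₀≡1 _ _ lhs≋rhs = begin
  act α A    ≈⟨ act≋act′ α A ⟩
  act′ α A   ≈⟨ act′-injective (⊗-isZm zα₁ zα₂) (positive-at-0 pα A₀≡1) (positive-at-0 pβ B₀≡1) γαA≋γβB ⟩
  act′ β B   ≈⟨ act≋act′ β B ⟨
  act β B    ∎
  where
  open SetoidReasoning multisetSetoid
  positive-at-0 : ∀ {γ C} → Positive γ → IsNm C → 1 ≤ act′ γ C 0
  positive-at-0 {C = C} pγ C₀≡1 = act′-zero-positive pγ C (≤-reflexive (sym C₀≡1))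
  γαA≋γβB : act′ (α₁ ⊗ α₂) (act′ α A) ≋ act′ (α₁ ⊗ α₂) (act′ β B)
  γαA≋γβB = begin
    act′ (α₁ ⊗ α₂) (act′ α A)   ≈⟨ act-⊗-act pα pα₁ pα₂ A ⟨
    act (α ⊗ α₂) (act α₁ A)     ≈⟨ lhs≋rhs ⟩
    act (β ⊗ β₂) (act β₁ B)     ≈⟨ act-⊗-act pβ pβ₁ pβ₂ B ⟩
    act′ (β₁ ⊗ β₂) (act′ β B)   ≡⟨ cong (λ γ → act′ γ (act′ β B)) α₁α₂≡β₁β₂ ⟨
    act′ (α₁ ⊗ α₂) (act′ β B)   ∎
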